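{- For every digraph $D$, $\vec{\Delta}(D) \leq \Delta_{\min}(D) \leq \Delta_{\max}(D)$.
   Context: Digraphs are finite with no loops and at most one arc from $u$ to $v$ for distinct $u,v$. For a total ordering $\prec$ of $V(D)$, the backedge graph $D^{\prec}$ is the undirected graph on $V(D)$ whose edges are the pairs $\{u,v\}$ with $(u,v)\in A(D)$ and $v\prec u$; the degreewidth is $\vec{\Delta}(D)=\min_{\prec}\Delta(D^{\prec})$ over all total orderings. For a vertex $v$ with out-degree $d^+(v)$ and in-degree $d^-(v)$, let $d_{\max}(v)=\max\{d^+(v),d^-(v)\}$ and $d_{\min}(v)=\min\{d^+(v),d^-(v)\}$; then $\Delta_{\max}(D)=\max_{v\in V(D)} d_{\max}(v)$ and $\Delta_{\min}(D)=\max_{v\in V(D)} d_{\min}(v)$. -}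

module Defs where

open import Data.Nat using (ℕ; zero; suc; _+_; _⊔_; _⊓_; _≤_)
open import Data.Fin using (Fin; zero; suc; _<?_)
open import Data.Fin.Permutation using (Permutation′; _⟨$⟩ʳ_)
open import Data.Bool using (Bool; true; false; _∧_; _∨_; if_then_else_)
open import Data.Product using (Σ-syntax)
open import Relation.Nullary.Decidable using (⌊_⌋)
open import Relation.Binary.PropositionalEquality using (_≡_)

-- A digraph on vertex set Fin n: arc u v = true iff (u,v) ∈ A(D).
-- At most one arc from u to v is automatic; no loops is imposed.
record Digraph (n : ℕ) : Set where
  field
    arc    : Fin n → Fin n → Bool
    noLoop : ∀ v → arc v v ≡ false
open Digraph public

count : ∀ {n} → (Fin n → Bool) → ℕ
count {zero}  p = 0
count {suc n} p = (if p zero then 1 else 0) + count (λ i → p (suc i))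

maxOver : ∀ {n} → (Fin n → ℕ) → ℕ
maxOver {zero}  f = 0
maxOver {suc n} f = f zero ⊔ maxOver (λ i → f (suc i))

outdeg indeg dmax dmin : ∀ {n} → Digraph n → Fin n → ℕ
outdeg D v = count (λ w → arc D v w)
indeg  D v = count (λ u → arc D u v)
dmax D v = outdeg D v ⊔ indeg D v
dmin D v = outdeg D v ⊓ indeg D v

Δmax Δmin : ∀ {n} → Digraph n → ℕ
Δmax D = maxOver (dmax D)
Δmin D = maxOver (dmin D)

-- A total ordering of Fin n, given by a permutation σ assigning each vertex
-- its position: u ≺ v iff σ u < σ v.  Every total order on Fin n arises so.
Ordering : ℕ → Set
Ordering n = Permutation′ n

_≺[_]_ : ∀ {n} → Fin n → Ordering n → Fin n → Bool
u ≺[ σ ] v = ⌊ (σ ⟨$⟩ʳ u) <? (σ ⟨$⟩ʳ v) ⌋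

backEdge : ∀ {n} → Digraph n → Ordering n → Fin n → Fin n → Bool
backEdge D σ u v = (arc D u v ∧ (v ≺[ σ ] u)) ∨ (arc D v u ∧ (u ≺[ σ ] v))

backDeg : ∀ {n} → Digraph n → Ordering n → Fin n → ℕ
backDeg D σ u = count (backEdge D σ u)

ΔBack : ∀ {n} → Digraph n → Ordering n → ℕ
ΔBack D σ = maxOver (backDeg D σ)

-- degreewidth(D) ≤ k  ⇔  min over orderings of Δ(D^≺) ≤ k
--                    ⇔  some ordering has Δ(D^≺) ≤ k
DegreewidthAtMost : ∀ {n} → Digraph n → ℕ → Set
DegreewidthAtMost D k = Σ[ σ ∈ Ordering _ ] ΔBack D σ ≤ k

{-# OPTIONS --safe #-}

-- Order the vertices so that the number of backward arcs is locally minimal.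
-- If a vertex v were incident to more backward arcs than its in-degree, moving
-- v to the front would make exactly its in-arcs backward and leave every other
-- arc unchanged, so the total would drop; symmetrically, moving v to the end
-- makes exactly its out-arcs backward. Hence at a local minimum every vertex is
-- incident to at most d_min(v) backward arcs, which bounds its degree in the
-- backedge graph.

module Submission where

open import Defs
open import Data.Bool using (Bool; true; false; _∧_; _∨_; if_then_else_; T)
open import Data.Bool.Properties using (∧-zeroʳ; ∧-identityʳ)
open import Data.Fin using (Fin; zero; suc; toℕ; fromℕ<; punchIn; punchOut; _≟_)
import Data.Fin as Fin
open import Data.Fin.Properties
  using (punchInᵢ≢i; punchOut-injective; injective⇒≤; toℕ-fromℕ<; toℕ-injective; any?)
open import Data.Fin.Permutation using (Permutation′; permutation)
open import Data.Nat using (ℕ; zero; suc; _+_; _≤_; _<_; _<ᵇ_; _<?_; z≤n; s≤s; z<s)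
open import Data.Nat.Induction using (<-wellFounded)
open import Data.Nat.Properties
  using ( module ≤-Reasoning; ≤-refl; ≤-reflexive; ≤-trans; <-trans; <-irrefl; <⇒≤; <⇒≢; ≤⇒≯; ≮⇒≥
        ; <-cmp; <ᵇ⇒<; <⇒<ᵇ; n≤1+n; n<1+n; m≤n⇒m≤1+n; suc-injective
        ; +-suc; +-identityʳ; +-monoʳ-≤; +-monoʳ-<; +-cancelʳ-<
        ; m≤m⊔n; m≤n⇒m≤o⊔n; ⊔-lub; ⊓-sel; m⊓n≤m⊔n
        ; +-0-commutativeMonoid; +-commutativeSemigroup)
open import Algebra.Properties.CommutativeSemigroup +-commutativeSemigroup using (x∙yz≈yx∙z; xy∙z≈zy∙x)
open import Algebra.Properties.CommutativeMonoid.Sum +-0-commutativeMonoid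
  using (sum; sum-remove; ∑-distrib-+; sum-cong-≗)
open import Data.Product using (Σ-syntax; ∃; _×_; _,_; proj₁; proj₂)
open import Data.Sum using (inj₁; inj₂)
open import Data.Unit using (tt)
open import Function using (_∘_)
open import Function.Definitions using (Injective)
open import Induction.WellFounded using (Acc; acc)
open import Relation.Binary.Definitions using (tri<; tri≈; tri>)
open import Relation.Binary.PropositionalEquality
open import Relation.Nullary using (contradiction)
open import Relation.Nullary.Decidable using (does; yes; no; dec-true; dec-false; isYes≗does)

𝟙 : Bool → ℕ
𝟙 b = if b then 1 else 0

count≡sum : ∀ {n} (p : Fin n → Bool) → count p ≡ sum (𝟙 ∘ p)
count≡sum {zero}  p = refl
count≡sum {suc n} p = cong (𝟙 (p zero) +_) (count≡sum (p ∘ suc))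

count-remove : ∀ {n} (p : Fin (suc n) → Bool) v → count p ≡ 𝟙 (p v) + count (p ∘ punchIn v)
count-remove p v = begin
  count p                          ≡⟨ count≡sum p ⟩
  sum (𝟙 ∘ p)                      ≡⟨ sum-remove (𝟙 ∘ p) ⟩
  𝟙 (p v) + sum (𝟙 ∘ p ∘ punchIn v) ≡⟨ cong (𝟙 (p v) +_) (count≡sum (p ∘ punchIn v)) ⟨
  𝟙 (p v) + count (p ∘ punchIn v)  ∎
  where open ≡-Reasoning

count-cong : ∀ {n} {p q : Fin n → Bool} → (∀ i → p i ≡ q i) → count p ≡ count q
count-cong {p = p} {q} p≗q = begin
  count p     ≡⟨ count≡sum p ⟩
  sum (𝟙 ∘ p) ≡⟨ sum-cong-≗ (cong 𝟙 ∘ p≗q) ⟩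
  sum (𝟙 ∘ q) ≡⟨ count≡sum q ⟨
  count q     ∎
  where open ≡-Reasoning

count-false : ∀ {n} {p : Fin n → Bool} → (∀ i → p i ≡ false) → count p ≡ 0
count-false {zero}  none = refl
count-false {suc n} none rewrite none zero = count-false (none ∘ suc)

count-≤ : ∀ {n} (p : Fin n → Bool) → count p ≤ n
count-≤ {zero}  p = z≤n
count-≤ {suc n} p with p zero
... | true  = s≤s (count-≤ (p ∘ suc))
... | false = m≤n⇒m≤1+n (count-≤ (p ∘ suc))

count-mono : ∀ {n} {p q : Fin n → Bool} → (∀ i → T (p i) → T (q i)) → count p ≤ count q
count-mono {zero}  p⇒q = z≤n
count-mono {suc n} {p} {q} p⇒q with p zero | q zero | p⇒q zero
... | false | false | _   = count-mono (p⇒q ∘ suc)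
... | false | true  | _   = m≤n⇒m≤1+n (count-mono (p⇒q ∘ suc))
... | true  | true  | _   = s≤s (count-mono (p⇒q ∘ suc))
... | true  | false | p⇒q₀ = contradiction tt p⇒q₀

count-∨ : ∀ {n} (p q : Fin n → Bool) → count (λ i → p i ∨ q i) ≤ count p + count q
count-∨ {zero}  p q = z≤n
count-∨ {suc n} p q with p zero | q zero | count-∨ (p ∘ suc) (q ∘ suc)
... | false | false | rest = rest
... | false | true  | rest = ≤-trans (s≤s rest) (≤-reflexive (sym (+-suc _ _)))
... | true  | false | rest = s≤s rest
... | true  | true  | rest = s≤s (≤-trans rest (+-monoʳ-≤ _ (n≤1+n _)))

count² : ∀ {n} → (Fin n → Fin n → Bool) → ℕ
count² P = sum (λ u → count (P u))

incident : ∀ {n} → (Fin n → Fin n → Bool) → Fin n → ℕ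
incident P v = count (P v) + count (λ u → P u v)

minor : ∀ {n} → (Fin (suc n) → Fin (suc n) → Bool) → Fin (suc n) → Fin n → Fin n → Bool
minor P v i j = P (punchIn v i) (punchIn v j)

count²-remove : ∀ {n} (P : Fin (suc n) → Fin (suc n) → Bool) v → P v v ≡ false →
                count² P ≡ incident P v + count² (minor P v)
count²-remove P v Pvv≡false = begin
  sum (λ u → count (P u))
    ≡⟨ sum-cong-≗ (λ u → count-remove (P u) v) ⟩
  sum (λ u → 𝟙 (P u v) + count (P u ∘ punchIn v))
    ≡⟨ ∑-distrib-+ (λ u → 𝟙 (P u v)) (λ u → count (P u ∘ punchIn v)) ⟩
  sum (λ u → 𝟙 (P u v)) + sum (λ u → count (P u ∘ punchIn v))
    ≡⟨ cong₂ _+_ (sym (count≡sum (λ u → P u v))) (sum-remove {i = v} (λ u → count (P u ∘ punchIn v))) ⟩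
  count (λ u → P u v) + (count (P v ∘ punchIn v) + count² (minor P v))
    ≡⟨ cong (λ c → count (λ u → P u v) + (c + count² (minor P v))) rowWithoutDiagonal ⟨
  count (λ u → P u v) + (count (P v) + count² (minor P v))
    ≡⟨ x∙yz≈yx∙z (count (λ u → P u v)) (count (P v)) (count² (minor P v)) ⟩
  incident P v + count² (minor P v) ∎
  where
  open ≡-Reasoning
  rowWithoutDiagonal : count (P v) ≡ count (P v ∘ punchIn v)
  rowWithoutDiagonal rewrite count-remove (P v) v | Pvv≡false = refl

count²-exchange : ∀ {n} (P Q : Fin n → Fin n → Bool) v →
                  (∀ {u w} → u ≢ v → w ≢ v → P u w ≡ Q u w) → P v v ≡ false → Q v v ≡ false →
                  count² P + incident Q v ≡ count² Q + incident P v
count²-exchange {zero}  _ _ ()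
count²-exchange {suc n} P Q v agree Pvv≡false Qvv≡false = begin
  count² P + incident Q v
    ≡⟨ cong (_+ incident Q v) (count²-remove P v Pvv≡false) ⟩
  incident P v + count² (minor P v) + incident Q v
    ≡⟨ cong (λ m → incident P v + m + incident Q v) sameMinor ⟩
  incident P v + count² (minor Q v) + incident Q v
    ≡⟨ xy∙z≈zy∙x (incident P v) (count² (minor Q v)) (incident Q v) ⟩
  incident Q v + count² (minor Q v) + incident P v
    ≡⟨ cong (_+ incident P v) (count²-remove Q v Qvv≡false) ⟨
  count² Q + incident P v ∎
  where
  open ≡-Reasoning
  sameMinor : count² (minor P v) ≡ count² (minor Q v)
  sameMinor = sum-cong-≗ (λ i → count-cong (λ j → agree (punchInᵢ≢i v i) (punchInᵢ≢i v j)))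

<⇒<ᵇ≡true : ∀ {m n} → m < n → (m <ᵇ n) ≡ true
<⇒<ᵇ≡true {m} {n} = dec-true (m <? n)

≥⇒<ᵇ≡false : ∀ {m n} → n ≤ m → (m <ᵇ n) ≡ false
≥⇒<ᵇ≡false {m} {n} n≤m = dec-false (m <? n) (≤⇒≯ n≤m)

-- A key k encodes the ordering in which u precedes w iff k u < k w; an
-- injective key yields a genuine Ordering by ranking (ordering-from-key).
Key : ℕ → Set
Key n = Fin n → ℕ

rank : ∀ {n} → Key n → Fin n → ℕ
rank k v = count (λ w → k w <ᵇ k v)

rank-split : ∀ {n} (k : Key (suc n)) u v → rank k v ≡ 𝟙 (k u <ᵇ k v) + count (λ i → k (punchIn u i) <ᵇ k v)
rank-split k u v = count-remove (λ w → k w <ᵇ k v) u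

rank-without-self : ∀ {n} (k : Key (suc n)) v → rank k v ≡ count (λ i → k (punchIn v i) <ᵇ k v)
rank-without-self k v = trans (rank-split k v v) (cong₂ _+_ (cong 𝟙 (≥⇒<ᵇ≡false (≤-refl {k v}))) refl)

rank<n : ∀ {n} (k : Key n) v → rank k v < n
rank<n {zero}  _ ()
rank<n {suc n} k v = begin-strict
  rank k v                             ≡⟨ rank-without-self k v ⟩
  count (λ i → k (punchIn v i) <ᵇ k v) <⟨ s≤s (count-≤ _) ⟩
  suc n                                ∎
  where open ≤-Reasoning

rank-strict : ∀ {n} (k : Key n) {u w} → k u < k w → rank k u < rank k w
rank-strict {zero}  _ {()}
rank-strict {suc n} k {u} {w} ku<kw = begin-strict
  rank k u                                               ≡⟨ rank-without-self k u ⟩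
  count (λ i → k (punchIn u i) <ᵇ k u)                   ≤⟨ count-mono below-u⇒below-w ⟩
  count (λ i → k (punchIn u i) <ᵇ k w)                   <⟨ n<1+n _ ⟩
  𝟙 true + count (λ i → k (punchIn u i) <ᵇ k w)          ≡⟨ cong₂ _+_ (cong 𝟙 (<⇒<ᵇ≡true ku<kw)) refl ⟨
  𝟙 (k u <ᵇ k w) + count (λ i → k (punchIn u i) <ᵇ k w)  ≡⟨ rank-split k u w ⟨
  rank k w                                               ∎
  where
  open ≤-Reasoning
  below-u⇒below-w : ∀ i → T (k (punchIn u i) <ᵇ k u) → T (k (punchIn u i) <ᵇ k w)
  below-u⇒below-w i below-u = <⇒<ᵇ (<-trans (<ᵇ⇒< _ _ below-u) ku<kw)

rank-<ᵇ : ∀ {n} (k : Key n) u w → (rank k u <ᵇ rank k w) ≡ (k u <ᵇ k w)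
rank-<ᵇ k u w with <-cmp (k u) (k w)
... | tri< ku<kw _ _ = trans (<⇒<ᵇ≡true (rank-strict k ku<kw)) (sym (<⇒<ᵇ≡true ku<kw))
... | tri≈ _ ku≡kw _ = trans (≥⇒<ᵇ≡false (≤-reflexive (sym ru≡rw))) (sym (≥⇒<ᵇ≡false (≤-reflexive (sym ku≡kw))))
  where
  ru≡rw : rank k u ≡ rank k w
  ru≡rw = cong (λ x → count (λ y → k y <ᵇ x)) ku≡kw
... | tri> _ _ kw<ku = trans (≥⇒<ᵇ≡false (<⇒≤ (rank-strict k kw<ku))) (sym (≥⇒<ᵇ≡false (<⇒≤ kw<ku)))

rank-injective : ∀ {n} {k : Key n} → Injective _≡_ _≡_ k → Injective _≡_ _≡_ (rank k)
rank-injective {k = k} inj {u} {w} ru≡rw with <-cmp (k u) (k w)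
... | tri< ku<kw _ _ = contradiction (rank-strict k ku<kw) (<-irrefl ru≡rw)
... | tri≈ _ ku≡kw _ = inj ku≡kw
... | tri> _ _ kw<ku = contradiction (rank-strict k kw<ku) (<-irrefl (sym ru≡rw))

rankFin : ∀ {n} → Key n → Fin n → Fin n
rankFin k v = fromℕ< (rank<n k v)

rankFin-injective : ∀ {n} {k : Key n} → Injective _≡_ _≡_ k → Injective _≡_ _≡_ (rankFin k)
rankFin-injective {k = k} inj {u} {w} eq =
  rank-injective inj (trans (sym (toℕ-fromℕ< (rank<n k u))) (trans (cong toℕ eq) (toℕ-fromℕ< (rank<n k w))))

injective⇒surjective : ∀ {n} (f : Fin n → Fin n) → Injective _≡_ _≡_ f → ∀ j → ∃ λ i → f i ≡ j
injective⇒surjective {zero}  _ _ ()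
injective⇒surjective {suc n} f inj j with any? (λ i → f i ≟ j)
... | yes hit = hit
... | no miss = contradiction (injective⇒≤ squeezed-injective) (<-irrefl refl)
  where
  j≢f : ∀ i → j ≢ f i
  j≢f i j≡fi = miss (i , sym j≡fi)
  squeezed-injective : Injective _≡_ _≡_ (λ i → punchOut (j≢f i))
  squeezed-injective eq = inj (punchOut-injective (j≢f _) (j≢f _) eq)

injective⇒permutation : ∀ {n} (f : Fin n → Fin n) → Injective _≡_ _≡_ f → Permutation′ n
injective⇒permutation f inj = permutation f (proj₁ ∘ onto) (proj₂ ∘ onto) (λ i → inj (proj₂ (onto (f i))))
  where
  onto : ∀ j → ∃ λ i → f i ≡ j
  onto = injective⇒surjective f inj

ordering-from-key : ∀ {n} (k : Key n) → Injective _≡_ _≡_ k →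
                    Σ[ σ ∈ Ordering n ] (∀ u w → (u ≺[ σ ] w) ≡ (k u <ᵇ k w))
ordering-from-key {n} k inj = σ , σ-order
  where
  σ : Ordering n
  σ = injective⇒permutation (rankFin k) (rankFin-injective inj)
  σ-order : ∀ u w → (u ≺[ σ ] w) ≡ (k u <ᵇ k w)
  σ-order u w = begin
    (u ≺[ σ ] w)
      ≡⟨ isYes≗does (rankFin k u Fin.<? rankFin k w) ⟩
    (toℕ (rankFin k u) <ᵇ toℕ (rankFin k w))
      ≡⟨ cong₂ _<ᵇ_ (toℕ-fromℕ< (rank<n k u)) (toℕ-fromℕ< (rank<n k w)) ⟩
    (rank k u <ᵇ rank k w)
      ≡⟨ rank-<ᵇ k u w ⟩
    (k u <ᵇ k w) ∎
    where open ≡-Reasoning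

maxOver-ub : ∀ {n} (f : Fin n → ℕ) i → f i ≤ maxOver f
maxOver-ub f zero    = m≤m⊔n _ _
maxOver-ub f (suc i) = m≤n⇒m≤o⊔n (f zero) (maxOver-ub (f ∘ suc) i)

maxOver-lub : ∀ {n} {f : Fin n → ℕ} {m} → (∀ i → f i ≤ m) → maxOver f ≤ m
maxOver-lub {zero}  f≤m = z≤n
maxOver-lub {suc n} f≤m = ⊔-lub (f≤m zero) (maxOver-lub (f≤m ∘ suc))

module _ {n : ℕ} where

  private variable
    k : Key n

  IsFirst IsLast : Key n → Fin n → Set
  IsFirst k v = ∀ {u} → u ≢ v → k v < k u
  IsLast  k v = ∀ {u} → u ≢ v → k u < k v

  OrderAgreesOff : Fin n → Key n → Key n → Set
  OrderAgreesOff v k k′ = ∀ {u w} → u ≢ v → w ≢ v → (k u <ᵇ k w) ≡ (k′ u <ᵇ k′ w)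

  toFront toEnd : Key n → Fin n → Key n
  toFront k v u = if does (u ≟ v) then 0 else suc (k u)
  toEnd   k v u = if does (u ≟ v) then suc (maxOver k) else k u

  toFront-self : ∀ k v → toFront k v v ≡ 0
  toFront-self k v = cong (λ b → if b then 0 else suc (k v)) (dec-true (v ≟ v) refl)

  toFront-other : ∀ k {u v} → u ≢ v → toFront k v u ≡ suc (k u)
  toFront-other k {u} {v} u≢v = cong (λ b → if b then 0 else suc (k u)) (dec-false (u ≟ v) u≢v)

  toEnd-self : ∀ k v → toEnd k v v ≡ suc (maxOver k)
  toEnd-self k v = cong (λ b → if b then suc (maxOver k) else k v) (dec-true (v ≟ v) refl)

  toEnd-other : ∀ k {u v} → u ≢ v → toEnd k v u ≡ k u
  toEnd-other k {u} {v} u≢v = cong (λ b → if b then suc (maxOver k) else k u) (dec-false (u ≟ v) u≢v)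

  toFront-first : ∀ k v → IsFirst (toFront k v) v
  toFront-first k v u≢v = subst₂ _<_ (sym (toFront-self k v)) (sym (toFront-other k u≢v)) z<s

  toEnd-last : ∀ k v → IsLast (toEnd k v) v
  toEnd-last k v {u} u≢v = subst₂ _<_ (sym (toEnd-other k u≢v)) (sym (toEnd-self k v)) (s≤s (maxOver-ub k u))

  toFront-agrees : ∀ k v → OrderAgreesOff v k (toFront k v)
  toFront-agrees k v u≢v w≢v = sym (cong₂ _<ᵇ_ (toFront-other k u≢v) (toFront-other k w≢v))

  toEnd-agrees : ∀ k v → OrderAgreesOff v k (toEnd k v)
  toEnd-agrees k v u≢v w≢v = sym (cong₂ _<ᵇ_ (toEnd-other k u≢v) (toEnd-other k w≢v))

  toFront-injective : ∀ v → Injective _≡_ _≡_ k → Injective _≡_ _≡_ (toFront k v)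
  toFront-injective v inj {u} {w} eq with u ≟ v | w ≟ v
  ... | yes refl | yes refl = refl
  ... | no _     | no _     = inj (suc-injective eq)
  ... | yes refl | no _     = contradiction eq λ ()
  ... | no _     | yes refl = contradiction eq λ ()

  toEnd-injective : ∀ v → Injective _≡_ _≡_ k → Injective _≡_ _≡_ (toEnd k v)
  toEnd-injective {k} v inj {u} {w} eq with u ≟ v | w ≟ v
  ... | yes refl | yes refl = refl
  ... | no _     | no _     = inj eq
  ... | yes refl | no _     = contradiction eq (<⇒≢ (s≤s (maxOver-ub k w)) ∘ sym)
  ... | no _     | yes refl = contradiction eq (<⇒≢ (s≤s (maxOver-ub k u)))

module _ {n} (D : Digraph n) where

  private variable
    k : Key n
    v : Fin n

  open ≤-Reasoning

  isBack : Key n → Fin n → Fin n → Bool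
  isBack k u w = arc D u w ∧ (k w <ᵇ k u)

  backArcs : Key n → ℕ
  backArcs k = count² (isBack k)

  backArcsAt : Key n → Fin n → ℕ
  backArcsAt k = incident (isBack k)

  loop-∧ : ∀ v b → arc D v v ∧ b ≡ false
  loop-∧ v b = cong (_∧ b) (noLoop D v)

  arc-∧-cong : ∀ u w {b c} → (u ≢ w → b ≡ c) → arc D u w ∧ b ≡ arc D u w ∧ c
  arc-∧-cong u w {b} {c} b≡c with u ≟ w
  ... | yes refl = trans (loop-∧ u b) (sym (loop-∧ u c))
  ... | no u≢w   = cong (arc D u w ∧_) (b≡c u≢w)

  backArcsAt-first : ∀ k v → IsFirst k v → backArcsAt k v ≡ indeg D v
  backArcsAt-first k v first = cong₂ _+_ noBackOut allBackIn
    where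
    noBackOut : count (isBack k v) ≡ 0
    noBackOut = count-false λ w →
      trans (arc-∧-cong v w (λ v≢w → ≥⇒<ᵇ≡false (<⇒≤ (first (≢-sym v≢w))))) (∧-zeroʳ _)
    allBackIn : count (λ u → isBack k u v) ≡ indeg D v
    allBackIn = count-cong λ u →
      trans (arc-∧-cong u v (λ u≢v → <⇒<ᵇ≡true (first u≢v))) (∧-identityʳ _)

  backArcsAt-last : ∀ k v → IsLast k v → backArcsAt k v ≡ outdeg D v
  backArcsAt-last k v last = trans (cong₂ _+_ allBackOut noBackIn) (+-identityʳ _)
    where
    allBackOut : count (isBack k v) ≡ outdeg D v
    allBackOut = count-cong λ w →
      trans (arc-∧-cong v w (λ v≢w → <⇒<ᵇ≡true (last (≢-sym v≢w)))) (∧-identityʳ _)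
    noBackIn : count (λ u → isBack k u v) ≡ 0
    noBackIn = count-false λ u →
      trans (arc-∧-cong u v (λ u≢v → ≥⇒<ᵇ≡false (<⇒≤ (last u≢v)))) (∧-zeroʳ _)

  backArcs-exchange : ∀ k k′ → OrderAgreesOff v k k′ →
                      backArcs k′ + backArcsAt k v ≡ backArcs k + backArcsAt k′ v
  backArcs-exchange {v} k k′ agree = count²-exchange _ _ v
    (λ {u} {w} u≢v w≢v → cong (arc D u w ∧_) (sym (agree w≢v u≢v))) (loop-∧ v _) (loop-∧ v _)

  backArcs-decreasing : ∀ k k′ → OrderAgreesOff v k k′ →
                        backArcsAt k′ v < backArcsAt k v → backArcs k′ < backArcs k
  backArcs-decreasing {v} k k′ agree fewerAtV =
    +-cancelʳ-< (backArcsAt k v) (backArcs k′) (backArcs k) (begin-strict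
      backArcs k′ + backArcsAt k v ≡⟨ backArcs-exchange k k′ agree ⟩
      backArcs k + backArcsAt k′ v <⟨ +-monoʳ-< (backArcs k) fewerAtV ⟩
      backArcs k + backArcsAt k v  ∎)

  improve : Injective _≡_ _≡_ k → dmin D v < backArcsAt k v →
            Σ[ k′ ∈ Key n ] Injective _≡_ _≡_ k′ × backArcs k′ < backArcs k
  improve {k} {v} inj excess with ⊓-sel (outdeg D v) (indeg D v)
  ... | inj₁ dmin≡out =
    toEnd k v , toEnd-injective v inj , backArcs-decreasing k (toEnd k v) (toEnd-agrees k v) (begin-strict
      backArcsAt (toEnd k v) v ≡⟨ backArcsAt-last (toEnd k v) v (toEnd-last k v) ⟩
      outdeg D v               ≡⟨ dmin≡out ⟨
      dmin D v                 <⟨ excess ⟩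
      backArcsAt k v           ∎)
  ... | inj₂ dmin≡in =
    toFront k v , toFront-injective v inj , backArcs-decreasing k (toFront k v) (toFront-agrees k v) (begin-strict
      backArcsAt (toFront k v) v ≡⟨ backArcsAt-first (toFront k v) v (toFront-first k v) ⟩
      indeg D v                  ≡⟨ dmin≡in ⟨
      dmin D v                   <⟨ excess ⟩
      backArcsAt k v             ∎)

  LocallyOptimal : Key n → Set
  LocallyOptimal k = ∀ v → backArcsAt k v ≤ dmin D v

  locally-optimal-key : Σ[ k ∈ Key n ] Injective _≡_ _≡_ k × LocallyOptimal k
  locally-optimal-key = descend toℕ toℕ-injective (<-wellFounded (backArcs toℕ))
    where
    descend : ∀ k → Injective _≡_ _≡_ k → Acc _<_ (backArcs k) →
              Σ[ k ∈ Key n ] Injective _≡_ _≡_ k × LocallyOptimal k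
    descend k inj (acc smaller) with any? (λ v → dmin D v <? backArcsAt k v)
    ... | no noExcess = k , inj , λ v → ≮⇒≥ (λ excess → noExcess (v , excess))
    ... | yes (v , excess) with improve inj excess
    ...   | k′ , inj′ , fewer = descend k′ inj′ (smaller fewer)

  backDeg≤backArcsAt : ∀ σ k → (∀ u w → (u ≺[ σ ] w) ≡ (k u <ᵇ k w)) →
                       ∀ u → backDeg D σ u ≤ backArcsAt k u
  backDeg≤backArcsAt σ k σ≈k u = begin
    backDeg D σ u
      ≡⟨ count-cong (λ w → cong₂ _∨_ (cong (arc D u w ∧_) (σ≈k w u)) (cong (arc D w u ∧_) (σ≈k u w))) ⟩
    count (λ w → isBack k u w ∨ isBack k w u)
      ≤⟨ count-∨ (isBack k u) (λ w → isBack k w u) ⟩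
    backArcsAt k u ∎

  degreewidth≤Δmin : DegreewidthAtMost D (Δmin D)
  degreewidth≤Δmin with k , inj , optimal ← locally-optimal-key
                   with σ , σ≈k ← ordering-from-key k inj =
    σ , maxOver-lub λ u → begin
      backDeg D σ u  ≤⟨ backDeg≤backArcsAt σ k σ≈k u ⟩
      backArcsAt k u ≤⟨ optimal u ⟩
      dmin D u       ≤⟨ maxOver-ub (dmin D) u ⟩
      Δmin D         ∎

Δmin≤Δmax : ∀ {n} (D : Digraph n) → Δmin D ≤ Δmax D
Δmin≤Δmax D = maxOver-lub λ v → ≤-trans (m⊓n≤m⊔n _ _) (maxOver-ub (dmax D) v)

lemma3p3 : ∀ {n} (D : Digraph n) →
    DegreewidthAtMost D (Δmin D) × Δmin D ≤ Δmax D
lemma3p3 D = degreewidth≤Δmin D , Δmin≤Δmax D
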